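{- Let $R=([n],\triangleright)$ be a rack with $n\geqslant 2$. Then for every $j\in S_{\leqslant\Delta}(R)\setminus T(R)$, \[ |M_j|\leqslant \frac{2n}{(\log_2 n)^2}. \]
   Context: Maps are written on the right; $(x)f_y=x\triangleright y$, each $f_y$ a permutation of $[n]$ with $f_{(y)f_z}=f_z^{ -1}f_yf_z$. For $S\subseteq[n]$, $G_S$ is the directed loopless multigraph on $[n]$ with an edge of colour $y$ from $x$ to $z$ iff $y\in S$, $x\neq z$, $(x)f_y=z$; components are those of the underlying undirected multigraph and $\mathrm{cp}(G)$ is their number. $d_R^+(v)=|\{(v)f_j: j\in[n],\ (v)f_j\neq v\}|$. Let $\Delta=(\log_2 n)^3$, $L=\lfloor(\log_2 n)^2\rfloor$, $S_{\leqslant\Delta}(R)=\{v: d_R^+(v)\leqslant\Delta\}$. $T(R)$: if $S_{\leqslant\Delta}(R)=\emptyset$, $T(R)=\emptyset$; otherwise order $S_{\leqslant\Delta}(R)$ as $u_1,u_2,\dots$ where $u_1$ minimises $\mathrm{cp}(G_{\{v\}})$ over $v\in S_{\leqslant\Delta}(R)$ and each $u_{k+1}$ minimises $\mathrm{cp}(G_{\{u_1,\dots,u_k,v\}})$ over $v\in S_{\leqslant\Delta}(R)\setminus\{u_1,\dots,u_k\}$; $T(R)=\{u_1,\dots,u_L\}$ if $|S_{\leqslant\Delta}(R)|\geqslant L$, else $T(R)=S_{\leqslant\Delta}(R)$. For a multigraph $G$ and multiset $E$ of vertex pairs, $M(G,E)$ is the set of vertex sets $C$ of components of $G$ such that some pair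 in $E$ joins a vertex of $C$ to a vertex outside $C$. $\overrightarrow{E}_j$ is the edge set of $G_{\{j\}}$ and $M_j = M(G_{T(R)},\overrightarrow{E}_j)$. -}

module Defs where

open import Data.Nat using (ℕ; zero; suc; _+_; _*_; _^_; _≤_; _<_)
open import Data.Fin using (Fin; toℕ)
open import Data.Fin.Properties using (any?) renaming (_≟_ to _≟ᶠ_)
open import Data.List using (List; length; filter; take; lookup; allFin)
open import Data.List.Membership.Propositional using (_∈_; _∉_)
open import Data.Product using (Σ; Σ-syntax; _×_; _,_)
open import Data.Sum using (_⊎_)
open import Data.Unit using (⊤)
open import Relation.Nullary using (¬_; Dec; yes; no)
open import Relation.Nullary.Decidable using (_×-dec_; ¬?)
open import Relation.Binary.PropositionalEquality using (_≡_; _≢_)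

-- Maps written on the right: (x)f_y = x ▷ y.
-- inv y is the inverse permutation f_y⁻¹ (so each f_y is a permutation),
-- and the axiom f_{(y)f_z} = f_z⁻¹ f_y f_z reads, applied to x,
--   x ▷ (y ▷ z) = ((x)f_z⁻¹ ▷ y) ▷ z.

record Rack (n : ℕ) : Set where
  field
    _▷_   : Fin n → Fin n → Fin n
    inv   : Fin n → Fin n → Fin n
    inv-left  : ∀ y x → inv y (x ▷ y) ≡ x
    inv-right : ∀ y x → (inv y x) ▷ y ≡ x
    rack-law  : ∀ x y z → x ▷ (y ▷ z) ≡ ((inv z x) ▷ y) ▷ z

module _ {n : ℕ} (R : Rack n) where
  open Rack R

  Edge : List (Fin n) → Fin n → Fin n → Set
  Edge S x z = Σ[ y ∈ Fin n ] (y ∈ S × x ≢ z × x ▷ y ≡ z)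

  data Conn (S : List (Fin n)) : Fin n → Fin n → Set where
    here : ∀ {x} → Conn S x x
    fwd  : ∀ {x z w} → Edge S x z → Conn S z w → Conn S x w
    bwd  : ∀ {x z w} → Edge S z x → Conn S z w → Conn S x w

  outdeg : Fin n → ℕ
  outdeg v = length (filter (λ x → ¬? (x ≟ᶠ v) ×-dec any? (λ j → (v ▷ j) ≟ᶠ x)) (allFin n))

  EdgeJ : Fin n → Fin n → Fin n → Set
  EdgeJ j x z = x ≢ z × x ▷ j ≡ z

  -- the component (of G_S) containing v belongs to M(G_S, E_j)
  InM : List (Fin n) → Fin n → Fin n → Set
  InM S j v = Σ[ x ∈ Fin n ] Σ[ z ∈ Fin n ]
                (EdgeJ j x z × ((Conn S v x × ¬ Conn S v z) ⊎ (Conn S v z × ¬ Conn S v x)))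

-- Counting classes: "the relation Rel has exactly m classes inside Q",
-- witnessed by m pairwise-inequivalent representatives covering Q.
NumClasses : {n : ℕ} → (Fin n → Fin n → Set) → (Fin n → Set) → ℕ → Set
NumClasses {n} Rel Q m =
  Σ[ reps ∈ (Fin m → Fin n) ]
    ((∀ i → Q (reps i)) ×
     (∀ i k → Rel (reps i) (reps k) → i ≡ k) ×
     (∀ v → Q v → Σ[ i ∈ Fin m ] Rel v (reps i)))

Cp : {n : ℕ} → Rack n → List (Fin n) → ℕ → Set
Cp R S c = NumClasses (Conn R S) (λ _ → ⊤) c

CardM : {n : ℕ} → Rack n → List (Fin n) → Fin n → ℕ → Set
CardM R S j m = NumClasses (Conn R S) (InM R S j) m

-- Exact comparisons with powers of log₂ n, encoded in ℕ.
-- (log₂ n)^k ≥ r/s  iff  every rational a/b (b>0) with (a/b)^k < r/s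
--                         satisfies a/b < log₂ n, i.e. 2^a < n^b.
Log2PowGE : ℕ → ℕ → ℕ → ℕ → Set
Log2PowGE k n r s = ∀ a b → 0 < b → a ^ k * s < r * b ^ k → 2 ^ a < n ^ b

-- (log₂ n)^k ≤ r/s  iff  every rational a/b (b>0) with (a/b)^k > r/s
--                         satisfies log₂ n < a/b, i.e. n^b < 2^a.
Log2PowLE : ℕ → ℕ → ℕ → ℕ → Set
Log2PowLE k n r s = ∀ a b → 0 < b → r * b ^ k < a ^ k * s → n ^ b < 2 ^ a

-- v ∈ S_{≤Δ}(R), Δ = (log₂ n)^3
InSΔ : {n : ℕ} → Rack n → Fin n → Set
InSΔ {n} R v = Log2PowGE 3 n (outdeg R v) 1

-- L = ⌊(log₂ n)^2⌋
IsL : ℕ → ℕ → Set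
IsL n L = Log2PowGE 2 n L 1 × ¬ Log2PowGE 2 n (suc L) 1

-- us = (u₁, …, u_ℓ) is an initial segment of a greedy ordering of S_{≤Δ}(R)
-- (any tie-breaking), of length min(L, |S_{≤Δ}(R)|); T(R) = set of its entries.
IsT : {n : ℕ} → Rack n → ℕ → List (Fin n) → Set
IsT {n} R L us =
  (∀ (i : Fin (length us)) →
     InSΔ R (lookup us i) ×
     lookup us i ∉ take (toℕ i) us ×
     (∀ v → InSΔ R v → v ∉ take (toℕ i) us →
        ∀ c c' → Cp R (lookup us i Data.List.∷ take (toℕ i) us) c
                → Cp R (v Data.List.∷ take (toℕ i) us) c' → c ≤ c'))
  × (length us ≡ L ⊎ (length us < L × (∀ v → InSΔ R v → v ∈ us)))

module Submission where

-- Write d(k) = cp(G_{u₁,…,u_k}) along the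
-- greedy sequence T = (u₁, …, u_L).  Since j ∈ S_{≤Δ}(R) \ T(R), the set
-- T(R) did not exhaust S_{≤Δ}(R), so |T| = L, and at every step j was a
-- candidate; hence d(k+1) ≤ cp(G_{u₁,…,u_k,j}).  The key combinatorial fact
-- (merge-count) is that adding the colour j to any A ⊆ T merges components
-- of G_A so that 2·cp(G_{A∪{j}}) + |M_j| ≤ 2·cp(G_A): each component in M_j
-- is crossed by a j-edge, which joins two different components of G_A.
-- Thus 2d(k+1) + m ≤ 2d(k); telescoping, with m ≤ cp(G_T) = d(L) and
-- d(0) ≤ n, gives (L+1)·m ≤ 2n.  Finally L + 1 > (log₂ n)² turns this into
-- (log₂ n)² ≤ 2n/m, which is the claim.

open import Defs
open import Data.Nat using (ℕ; zero; suc; _+_; _*_; _^_; _≤_; _<_; _<?_; z≤n; s≤s; NonZero; >-nonZero)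
open import Data.Nat.Properties
  using (≤-refl; ≤-trans; ≤-reflexive; <⇒≤; ≮⇒≥; <⇒≱; ≤⇒≯; n≮0; n≢0⇒n>0; m<n⇒m<1+n; m≤m+n;
         +-assoc; +-identityʳ; +-mono-≤; +-monoˡ-≤; *-comm; *-zeroʳ; *-identityʳ; m*n≢0;
         *-monoˡ-≤; *-monoˡ-<; *-cancelʳ-<; ^-*-assoc; ^-monoˡ-≤; ^-monoʳ-<; m^n>0; module ≤-Reasoning)
open import Data.Nat.Tactic.RingSolver using (solve-∀)
open import Data.Fin using (Fin; zero; suc; toℕ; fromℕ<)
open import Data.Fin.Properties using (_≟_; any?; injective⇒≤; toℕ-fromℕ<; +↔⊎)
open import Data.List using (List; []; _∷_; [_]; take; lookup; length; allFin; cartesianProductWith)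
open import Data.List.Properties using (take-suc; take-all; take++drop≡id)
open import Data.List.Membership.Propositional using (_∈_; _∉_)
open import Data.List.Membership.Propositional.Properties
  using (∈-allFin; ∈-cartesianProductWith⁺; ∈-cartesianProductWith⁻)
open import Data.List.Relation.Binary.Subset.Propositional using (_⊆_)
open import Data.List.Relation.Binary.Subset.Propositional.Properties
  using (⊆-reflexive; ⊆-trans; xs⊆xs++ys; xs⊆ys++xs; ∈-∷⁺ʳ)
open import Data.List.Relation.Unary.Any using (here; there)
open import Data.Product using (Σ; _×_; _,_; proj₁; proj₂)
open import Data.Sum using (_⊎_; inj₁; inj₂)
open import Data.Sum.Properties using (inj₁-injective; inj₂-injective)
open import Data.Sum.Function.Propositional using (_⊎-↔_)
open import Data.Unit using (⊤; tt)
open import Data.Empty using (⊥; ⊥-elim)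
open import Function using (_∘_; Injective; Injection; _↣_; mk↣)
open import Function.Construct.Composition using (_↣-∘_; _↔-∘_)
open import Function.Properties.Inverse using (↔-sym; ↔-refl; ↔⇒↣)
open import Relation.Nullary using (¬_; Dec; yes; no)
open import Relation.Nullary.Decidable using (map′)
open import Relation.Binary.Definitions using (Decidable; Reflexive; Symmetric)
open import Relation.Binary.Structures using (IsEquivalence)
open import Relation.Binary.PropositionalEquality
  using (_≡_; _≢_; refl; sym; trans; cong; subst; module ≡-Reasoning)

module Classes {n : ℕ} {_~_ : Fin n → Fin n → Set} (isEq : IsEquivalence _~_)
               {Q : Fin n → Set} {m : ℕ} (N : NumClasses _~_ Q m) where
  open IsEquivalence isEq using () renaming (sym to ~-sym; trans to ~-trans)

  rep : Fin m → Fin n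
  rep = proj₁ N

  rep-Q : ∀ i → Q (rep i)
  rep-Q = proj₁ (proj₂ N)

  rep-distinct : ∀ i k → rep i ~ rep k → i ≡ k
  rep-distinct = proj₁ (proj₂ (proj₂ N))

  classOf : ∀ v → Q v → Fin m
  classOf v q = proj₁ (proj₂ (proj₂ (proj₂ N)) v q)

  ~rep : ∀ v q → v ~ rep (classOf v q)
  ~rep v q = proj₂ (proj₂ (proj₂ (proj₂ N)) v q)

  same-class⇒~ : ∀ x qx y qy → classOf x qx ≡ classOf y qy → x ~ y
  same-class⇒~ x qx y qy e =
    ~-trans (~rep x qx) (~-sym (subst (λ i → y ~ rep i) (sym e) (~rep y qy)))

  ~⇒same-class : ∀ x qx y qy → x ~ y → classOf x qx ≡ classOf y qy
  ~⇒same-class x qx y qy x~y =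
    rep-distinct _ _ (~-trans (~-sym (~rep x qx)) (~-trans x~y (~rep y qy)))

  classOf-rep : ∀ i q → classOf (rep i) q ≡ i
  classOf-rep i q = sym (rep-distinct i _ (~rep (rep i) q))

-- A finer relation, counted on a larger domain, has at least as many classes:
-- send each class of _~_ to the _≈_-class of its representative.
classes-mono : ∀ {n} {_~_ _≈_ : Fin n → Fin n → Set} {Q Q' : Fin n → Set} {a b} →
               IsEquivalence _≈_ → (∀ {x y} → x ≈ y → x ~ y) → (∀ {x} → Q x → Q' x) →
               NumClasses _~_ Q a → NumClasses _≈_ Q' b → a ≤ b
classes-mono {a = a} {b} isEq ≈⇒~ Q⇒Q' N N' = injective⇒≤ {f = f} f-injective
  where
    module C = Classes isEq N'
    f : Fin a → Fin b
    f i = C.classOf (proj₁ N i) (Q⇒Q' (proj₁ (proj₂ N) i))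
    f-injective : ∀ {i k} → f i ≡ f k → i ≡ k
    f-injective {i} {k} e = proj₁ (proj₂ (proj₂ N)) i k (≈⇒~ (C.same-class⇒~ _ _ _ _ e))

-- A decidable reflexive symmetric relation on Fin n admits a system of
-- representatives: choose them among 1 … n-1 recursively, and add 0 unless
-- it is already related to one of them.
classes-exist : ∀ n (_~_ : Fin n → Fin n → Set) → Decidable _~_ →
                Reflexive _~_ → Symmetric _~_ → Σ ℕ (NumClasses _~_ (λ _ → ⊤))
classes-exist zero _~_ _ _ _ = 0 , (λ ()) , (λ ()) , (λ ()) , (λ ())
classes-exist (suc n) _~_ _~?_ ~-refl ~-sym
  with classes-exist n (λ x y → suc x ~ suc y) (λ x y → suc x ~? suc y) ~-refl ~-sym
... | m , rep , _ , rep-distinct , cover with any? (λ i → zero ~? suc (rep i))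
...   | yes (i₀ , 0~i₀) = m , suc-rep , (λ _ → tt) , rep-distinct , cover′
  where
    suc-rep : Fin m → Fin (suc n)
    suc-rep i = suc (rep i)
    cover′ : ∀ v → ⊤ → Σ (Fin m) λ i → v ~ suc-rep i
    cover′ zero    _ = i₀ , 0~i₀
    cover′ (suc v) _ = cover v tt
...   | no 0≁reps = suc m , rep′ , (λ _ → tt) , distinct′ , cover′
  where
    rep′ : Fin (suc m) → Fin (suc n)
    rep′ zero    = zero
    rep′ (suc i) = suc (rep i)
    distinct′ : ∀ i k → rep′ i ~ rep′ k → i ≡ k
    distinct′ zero    zero    _ = refl
    distinct′ zero    (suc k) r = ⊥-elim (0≁reps (k , r))
    distinct′ (suc i) zero    r = ⊥-elim (0≁reps (i , ~-sym r))
    distinct′ (suc i) (suc k) r = cong suc (rep-distinct i k r)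
    cover′ : ∀ v → ⊤ → Σ (Fin (suc m)) λ i → v ~ rep′ i
    cover′ zero    _ = zero , ~-refl
    cover′ (suc v) _ with cover v tt
    ... | i , v~i = suc i , v~i

-- Distinct representatives of a reflexive relation are distinct elements.
classes-bound : ∀ {n} {_~_ : Fin n → Fin n → Set} {Q : Fin n → Set} {c} →
                Reflexive _~_ → NumClasses _~_ Q c → c ≤ n
classes-bound {_~_ = _~_} ~-refl (rep , _ , rep-distinct , _) =
  injective⇒≤ {f = rep} λ {i} {k} e → rep-distinct i k (subst (rep i ~_) e ~-refl)

module _ {n : ℕ} where

  data Closure (G : Fin n → Fin n → Set) : Fin n → Fin n → Set where
    here : ∀ {x} → Closure G x x
    fwd  : ∀ {x z w} → G x z → Closure G z w → Closure G x w
    bwd  : ∀ {x z w} → G z x → Closure G z w → Closure G x w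

  module _ {G : Fin n → Fin n → Set} where
    closure-trans : ∀ {x y z} → Closure G x y → Closure G y z → Closure G x z
    closure-trans here      q = q
    closure-trans (fwd g p) q = fwd g (closure-trans p q)
    closure-trans (bwd g p) q = bwd g (closure-trans p q)

    closure-sym : ∀ {x y} → Closure G x y → Closure G y x
    closure-sym here      = here
    closure-sym (fwd g p) = closure-trans (closure-sym p) (bwd g here)
    closure-sym (bwd g p) = closure-trans (closure-sym p) (fwd g here)

  closure-map : ∀ {G G' : Fin n → Fin n → Set} → (∀ {x y} → G x y → Closure G' x y) →
                ∀ {x y} → Closure G x y → Closure G' x y
  closure-map f here      = here
  closure-map f (fwd g p) = closure-trans (f g) (closure-map f p)
  closure-map f (bwd g p) = closure-trans (closure-sym (f g)) (closure-map f p)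

  PairIn : List (Fin n × Fin n) → Fin n → Fin n → Set
  PairIn ps x y = (x , y) ∈ ps

  record Labelling (ps : List (Fin n × Fin n)) : Set where
    field
      label    : Fin n → Fin n
      sound    : ∀ {x y} → Closure (PairIn ps) x y → label x ≡ label y
      complete : ∀ {x y} → label x ≡ label y → Closure (PairIn ps) x y

  relabel : Fin n → Fin n → Fin n → Fin n
  relabel u w t with t ≟ u
  ... | yes _ = w
  ... | no  _ = t

  relabel-hit : ∀ {u w t} → t ≡ u → relabel u w t ≡ w
  relabel-hit {u} {w} {t} t≡u with t ≟ u
  ... | yes _   = refl
  ... | no  t≢u = ⊥-elim (t≢u t≡u)

  relabel-miss : ∀ {u w t} → t ≢ u → relabel u w t ≡ t
  relabel-miss {u} {w} {t} t≢u with t ≟ u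
  ... | yes t≡u = ⊥-elim (t≢u t≡u)
  ... | no  _   = refl

  relabel-target : ∀ u w → relabel u w w ≡ w
  relabel-target u w with w ≟ u
  ... | yes _ = refl
  ... | no  _ = refl

  -- Every finite list of pairs has a labelling (a union–find without
  -- path compression): add the pairs one at a time, identifying two labels.
  labelling : (ps : List (Fin n × Fin n)) → Labelling ps
  labelling [] = record { label = λ v → v ; sound = sound ; complete = λ { refl → here } }
    where
      sound : ∀ {x y} → Closure (PairIn []) x y → x ≡ y
      sound here = refl
  labelling ((a , b) ∷ ps) = record { label = label ; sound = sound ; complete = complete }
    where
      open Labelling (labelling ps) using () renaming
        (label to label′; sound to sound′; complete to complete′)
      G : Fin n → Fin n → Set
      G = PairIn ((a , b) ∷ ps)

      label : Fin n → Fin n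
      label v = relabel (label′ a) (label′ b) (label′ v)

      sound-edge : ∀ {x z} → G x z → label x ≡ label z
      sound-edge (here refl) =
        trans (relabel-hit {label′ a} refl) (sym (relabel-target (label′ a) (label′ b)))
      sound-edge (there g)   = cong (relabel (label′ a) (label′ b)) (sound′ (fwd g here))

      sound : ∀ {x y} → Closure G x y → label x ≡ label y
      sound here      = refl
      sound (fwd g p) = trans (sound-edge g) (sound p)
      sound (bwd g p) = trans (sym (sound-edge g)) (sound p)

      old : ∀ {x y} → label′ x ≡ label′ y → Closure G x y
      old e = closure-map (λ g → fwd (there g) here) (complete′ e)

      a—b : Closure G a b
      a—b = fwd (here refl) here

      complete : ∀ {x y} → label x ≡ label y → Closure G x y
      complete {x} {y} e = by-cases (label′ x ≟ label′ a) (label′ y ≟ label′ a)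
        where
          by-cases : Dec (label′ x ≡ label′ a) → Dec (label′ y ≡ label′ a) → Closure G x y
          by-cases (yes xa) (yes ya) = old (trans xa (sym ya))
          by-cases (yes xa) (no ya)  = closure-trans (old xa) (closure-trans a—b
            (old (trans (sym (relabel-hit xa)) (trans e (relabel-miss ya)))))
          by-cases (no xa)  (yes ya) = closure-trans
            (old (trans (sym (relabel-miss xa)) (trans e (relabel-hit ya))))
            (closure-trans (closure-sym a—b) (old (sym ya)))
          by-cases (no xa)  (no ya)  = old (trans (sym (relabel-miss xa)) (trans e (relabel-miss ya)))

  closure-dec : ∀ ps x y → Dec (Closure (PairIn ps) x y)
  closure-dec ps x y = map′ complete sound (label x ≟ label y)
    where open Labelling (labelling ps)

injection-count : ∀ {a b d e} (f : (Fin a ⊎ Fin b) ⊎ Fin d → Fin e ⊎ Fin e) →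
                  Injective _≡_ _≡_ f → (a + b) + d ≤ e + e
injection-count {a} {b} {d} {e} f f-inj = injective⇒≤ (Injection.injective embedding)
  where
    embedding : Fin ((a + b) + d) ↣ Fin (e + e)
    embedding = ↔⇒↣ (↔-sym +↔⊎) ↣-∘ (mk↣ f-inj ↣-∘ ↔⇒↣ ((+↔⊎ ⊎-↔ ↔-refl) ↔-∘ +↔⊎))

record Crossing {n : ℕ} (_≈B_ _≈J_ : Fin n → Fin n → Set) (v : Fin n) : Set where
  field
    p q   : Fin n
    v≈p   : v ≈B p
    v≉q   : ¬ v ≈B q
    p≈q   : p ≈J q

-- Let ≈A be finer than both ≈B and ≈J, with c and c′
-- classes for ≈A and ≈J, and let m classes of ≈B be crossed by ≈J-pairs.
-- Then 2c′ + m ≤ 2c: every crossed ≈B-class meets a ≈J-class that merges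
-- several ≈A-classes.  Concretely, we inject the ≈J-classes (twice) and the
-- crossed classes into two copies of the ≈A-classes.  Each ≈J-class K goes
-- to its top ≈A-class (the one of its representative) in both copies; a
-- crossed class with crossing pair (p , q) goes to the ≈A-class of p in the
-- first copy if that one is not top, and otherwise to the ≈A-class of q in
-- the second copy (q is ≈J-related to p but not ≈A-related, so not top).
module _ {n : ℕ} {_≈A_ _≈B_ _≈J_ : Fin n → Fin n → Set}
         (eqA : IsEquivalence _≈A_) (eqB : IsEquivalence _≈B_) (eqJ : IsEquivalence _≈J_)
         (A⇒B : ∀ {x y} → x ≈A y → x ≈B y) (A⇒J : ∀ {x y} → x ≈A y → x ≈J y)
         {Q : Fin n → Set} (crossing : ∀ v → Q v → Crossing _≈B_ _≈J_ v)
         {c c′ m : ℕ} (NA : NumClasses _≈A_ (λ _ → ⊤) c)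
         (NJ : NumClasses _≈J_ (λ _ → ⊤) c′) (NB : NumClasses _≈B_ Q m) where

  private
    module A = Classes eqA NA
    module J = Classes eqJ NJ
    module B = Classes eqB NB
    open IsEquivalence eqA using () renaming (sym to A-sym)
    open IsEquivalence eqB using () renaming (sym to B-sym; trans to B-trans)

    classA : Fin n → Fin c
    classA v = A.classOf v tt

    classJ : Fin n → Fin c′
    classJ v = J.classOf v tt

    A-related : ∀ {x y} → classA x ≡ classA y → x ≈A y
    A-related = A.same-class⇒~ _ tt _ tt

    J-class : ∀ {x y} → x ≈J y → classJ x ≡ classJ y
    J-class = J.~⇒same-class _ tt _ tt

    top : Fin c′ → Fin c
    top K = classA (J.rep K)

    IsTop : Fin c → Set
    IsTop d = d ≡ top (classJ (A.rep d))

    classJ-repA : ∀ v → classJ (A.rep (classA v)) ≡ classJ v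
    classJ-repA v = J-class (A⇒J (A-sym (A.~rep v tt)))

    classJ-of-top : ∀ {K v} → top K ≡ classA v → classJ v ≡ K
    classJ-of-top {K} e = trans (J-class (A⇒J (A-sym (A-related e)))) (J.classOf-rep K tt)

    top-isTop : ∀ K → IsTop (top K)
    top-isTop K = cong top (sym (trans (classJ-repA (J.rep K)) (J.classOf-rep K tt)))

    top-injective : ∀ {K K′} → top K ≡ top K′ → K ≡ K′
    top-injective e = J.rep-distinct _ _ (A⇒J (A-related e))

    module _ (C : Fin m) where
      open Crossing (crossing (B.rep C) (B.rep-Q C)) public

    p-injective : ∀ {C C′} → classA (p C) ≡ classA (p C′) → C ≡ C′
    p-injective {C} {C′} e =
      B.rep-distinct C C′ (B-trans (v≈p C) (B-trans (A⇒B (A-related e)) (B-sym (v≈p C′))))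

    q≉p : ∀ C → classA (q C) ≡ classA (p C) → ⊥
    q≉p C e = v≉q C (B-trans (v≈p C) (B-sym (A⇒B (A-related e))))

    top-of-p : ∀ C → IsTop (classA (p C)) → classA (p C) ≡ top (classJ (q C))
    top-of-p C t = trans t (cong top (trans (classJ-repA (p C)) (J-class (p≈q C))))

    placeC : ∀ C → Dec (IsTop (classA (p C))) → Fin c ⊎ Fin c
    placeC C (yes _) = inj₂ (classA (q C))
    placeC C (no  _) = inj₁ (classA (p C))

    place : (Fin c′ ⊎ Fin c′) ⊎ Fin m → Fin c ⊎ Fin c
    place (inj₁ (inj₁ K)) = inj₁ (top K)
    place (inj₁ (inj₂ K)) = inj₂ (top K)
    place (inj₂ C)        = placeC C (classA (p C) ≟ top (classJ (A.rep (classA (p C)))))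

    top≢placeC₁ : ∀ K C x → inj₁ (top K) ≡ placeC C x → ⊥
    top≢placeC₁ K C (yes _) ()
    top≢placeC₁ K C (no ¬t) e = ¬t (subst IsTop (inj₁-injective e) (top-isTop K))

    top≢placeC₂ : ∀ K C x → inj₂ (top K) ≡ placeC C x → ⊥
    top≢placeC₂ K C (no _)  ()
    top≢placeC₂ K C (yes t) e = q≉p C (sym (begin
        classA (p C)          ≡⟨ top-of-p C t ⟩
        top (classJ (q C))    ≡⟨ cong top (classJ-of-top (inj₂-injective e)) ⟩
        top K                 ≡⟨ inj₂-injective e ⟩
        classA (q C)          ∎))
      where open ≡-Reasoning

    placeC-injective : ∀ C C′ x x′ → placeC C x ≡ placeC C′ x′ → C ≡ C′
    placeC-injective C C′ (no _)  (no _)   e = p-injective (inj₁-injective e)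
    placeC-injective C C′ (no _)  (yes _)  ()
    placeC-injective C C′ (yes _) (no _)   ()
    placeC-injective C C′ (yes t) (yes t′) e = p-injective (begin
        classA (p C)          ≡⟨ top-of-p C t ⟩
        top (classJ (q C))    ≡⟨ cong top (J-class (A⇒J (A-related (inj₂-injective e)))) ⟩
        top (classJ (q C′))   ≡⟨ sym (top-of-p C′ t′) ⟩
        classA (p C′)         ∎)
      where open ≡-Reasoning

    place-injective : Injective _≡_ _≡_ place
    place-injective {inj₁ (inj₁ K)} {inj₁ (inj₁ K′)} e =
      cong (inj₁ ∘ inj₁) (top-injective (inj₁-injective e))
    place-injective {inj₁ (inj₂ K)} {inj₁ (inj₂ K′)} e =
      cong (inj₁ ∘ inj₂) (top-injective (inj₂-injective e))
    place-injective {inj₁ (inj₁ K)} {inj₁ (inj₂ K′)} ()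
    place-injective {inj₁ (inj₂ K)} {inj₁ (inj₁ K′)} ()
    place-injective {inj₁ (inj₁ K)} {inj₂ C}         e = ⊥-elim (top≢placeC₁ K C _ e)
    place-injective {inj₁ (inj₂ K)} {inj₂ C}         e = ⊥-elim (top≢placeC₂ K C _ e)
    place-injective {inj₂ C}        {inj₁ (inj₁ K)}  e = ⊥-elim (top≢placeC₁ K C _ (sym e))
    place-injective {inj₂ C}        {inj₁ (inj₂ K)}  e = ⊥-elim (top≢placeC₂ K C _ (sym e))
    place-injective {inj₂ C}        {inj₂ C′}        e = cong inj₂ (placeC-injective C C′ _ _ e)

  merge-count : (c′ + c′) + m ≤ c + c
  merge-count = injection-count place place-injective

module Connectivity {n : ℕ} (R : Rack n) where
  open Rack R

  conn-trans : ∀ {S x y z} → Conn R S x y → Conn R S y z → Conn R S x z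
  conn-trans here      q = q
  conn-trans (fwd g p) q = fwd g (conn-trans p q)
  conn-trans (bwd g p) q = bwd g (conn-trans p q)

  conn-sym : ∀ {S x y} → Conn R S x y → Conn R S y x
  conn-sym here      = here
  conn-sym (fwd g p) = conn-trans (conn-sym p) (bwd g here)
  conn-sym (bwd g p) = conn-trans (conn-sym p) (fwd g here)

  Conn-isEquivalence : ∀ S → IsEquivalence (Conn R S)
  Conn-isEquivalence S = record { refl = here ; sym = conn-sym ; trans = conn-trans }

  conn-mono : ∀ {S S′} → S ⊆ S′ → ∀ {x y} → Conn R S x y → Conn R S′ x y
  conn-mono S⊆S′ here                     = here
  conn-mono S⊆S′ (fwd (y , y∈S , x≢z , e) p) = fwd (y , S⊆S′ y∈S , x≢z , e) (conn-mono S⊆S′ p)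
  conn-mono S⊆S′ (bwd (y , y∈S , x≢z , e) p) = bwd (y , S⊆S′ y∈S , x≢z , e) (conn-mono S⊆S′ p)

  -- G_S as an explicit list of pairs (x , x ▷ y), y ∈ S (loops included:
  -- they do not change connectivity).
  edgePairs : List (Fin n) → List (Fin n × Fin n)
  edgePairs S = cartesianProductWith (λ x y → x , x ▷ y) (allFin n) S

  conn⇒closure : ∀ {S x y} → Conn R S x y → Closure (PairIn (edgePairs S)) x y
  conn⇒closure here = here
  conn⇒closure (fwd {x = x} (y , y∈S , _ , refl) p) =
    fwd (∈-cartesianProductWith⁺ _ (∈-allFin x) y∈S) (conn⇒closure p)
  conn⇒closure (bwd {z = z} (y , y∈S , _ , refl) p) =
    bwd (∈-cartesianProductWith⁺ _ (∈-allFin z) y∈S) (conn⇒closure p)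

  edgePair⇒conn : ∀ {S x z} → (x , z) ∈ edgePairs S → Conn R S x z
  edgePair⇒conn {S} xz∈ with ∈-cartesianProductWith⁻ _ (allFin n) S xz∈
  ... | x , y , _ , y∈S , refl with x ≟ x ▷ y
  ...   | yes loop = subst (Conn R S x) loop here
  ...   | no  x≢z  = fwd (y , y∈S , x≢z , refl) here

  closure⇒conn : ∀ {S x y} → Closure (PairIn (edgePairs S)) x y → Conn R S x y
  closure⇒conn here      = here
  closure⇒conn (fwd g p) = conn-trans (edgePair⇒conn g) (closure⇒conn p)
  closure⇒conn (bwd g p) = conn-trans (conn-sym (edgePair⇒conn g)) (closure⇒conn p)

  conn-dec : ∀ S x y → Dec (Conn R S x y)
  conn-dec S x y = map′ closure⇒conn conn⇒closure (closure-dec (edgePairs S) x y)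

  cp-exists : ∀ S → Σ ℕ (Cp R S)
  cp-exists S = classes-exist n (Conn R S) (conn-dec S) here conn-sym

  cp-bound : ∀ {S c} → Cp R S c → c ≤ n
  cp-bound {S} = classes-bound {_~_ = Conn R S} here

  cp-antitone : ∀ {S S′ c c′} → S ⊆ S′ → Cp R S′ c′ → Cp R S c → c′ ≤ c
  cp-antitone {S} S⊆S′ = classes-mono (Conn-isEquivalence S) (conn-mono S⊆S′) (λ q → q)

  -- M(G_S, E_j) consists of components of G_S
  cardM≤cp : ∀ {S j m c} → CardM R S j m → Cp R S c → m ≤ c
  cardM≤cp {S} = classes-mono (Conn-isEquivalence S) (λ p → p) (λ _ → tt)

  InM⇒crossing : ∀ {A B j v} → InM R B j v → Crossing (Conn R B) (Conn R (j ∷ A)) v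
  InM⇒crossing {j = j} (x , z , (x≢z , x▷j≡z) , inj₁ (v—x , v≁z)) =
    record { p = x ; q = z ; v≈p = v—x ; v≉q = v≁z ; p≈q = fwd (j , here refl , x≢z , x▷j≡z) here }
  InM⇒crossing {j = j} (x , z , (x≢z , x▷j≡z) , inj₂ (v—z , v≁x)) =
    record { p = z ; q = x ; v≈p = v—z ; v≉q = v≁x ; p≈q = bwd (j , here refl , x≢z , x▷j≡z) here }

  cp-drop : ∀ {A B j c c′ m} → A ⊆ B → Cp R A c → Cp R (j ∷ A) c′ → CardM R B j m →
            (c′ + c′) + m ≤ c + c
  cp-drop {A} {B} {j} A⊆B =
    merge-count (Conn-isEquivalence A) (Conn-isEquivalence B) (Conn-isEquivalence (j ∷ A))
                (conn-mono A⊆B) (conn-mono there) (λ v → InM⇒crossing)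

*-^ : ∀ x y k → (x * y) ^ k ≡ x ^ k * y ^ k
*-^ x y zero    = refl
*-^ x y (suc k) = trans (cong ((x * y) *_) (*-^ x y k)) (interchange x y (x ^ k) (y ^ k))
  where
    interchange : ∀ x y X Y → (x * y) * (X * Y) ≡ (x * X) * (y * Y)
    interchange = solve-∀

^-cancelˡ-< : ∀ k {x y} → x ^ k < y ^ k → x < y
^-cancelˡ-< k {x} {y} lt with x <? y
... | yes x<y = x<y
... | no  x≮y = ⊥-elim (<⇒≱ lt (^-monoˡ-≤ k (≮⇒≥ x≮y)))

-- a / b ≤ log₂ n ≤ a′ / b′, written with powers, gives a · b′ ≤ a′ · b
log-sandwich : ∀ {n a b a′ b′} → 2 ^ a ≤ n ^ b → n ^ b′ ≤ 2 ^ a′ → a * b′ ≤ a′ * b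
log-sandwich {n} {a} {b} {a′} {b′} lower upper with a′ * b <? a * b′
... | no  ≮ = ≮⇒≥ ≮
... | yes lt = ⊥-elim (<⇒≱ (^-monoʳ-< 2 (s≤s (s≤s z≤n)) lt) (begin
    2 ^ (a * b′)   ≡⟨ sym (^-*-assoc 2 a b′) ⟩
    (2 ^ a) ^ b′   ≤⟨ ^-monoˡ-≤ b′ lower ⟩
    (n ^ b) ^ b′   ≡⟨ ^-*-assoc n b b′ ⟩
    n ^ (b * b′)   ≡⟨ cong (n ^_) (*-comm b b′) ⟩
    n ^ (b′ * b)   ≡⟨ sym (^-*-assoc n b′ b) ⟩
    (n ^ b′) ^ b   ≤⟨ ^-monoˡ-≤ b upper ⟩
    (2 ^ a′) ^ b   ≡⟨ ^-*-assoc 2 a′ b ⟩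
    2 ^ (a′ * b)   ∎))
  where open ≤-Reasoning

-- Comparing ratios through k-th powers: (a′/b′)^k < r/s ≤ r′/s′ < (a/b)^k,
-- with cleared denominators, gives a′/b′ < a/b.
power-ratio-< : ∀ k {a b a′ b′ r s r′ s′} → 0 < b →
                a′ ^ k * s < r * b′ ^ k → r * s′ ≤ r′ * s → r′ * b ^ k < a ^ k * s′ →
                a′ * b < a * b′
power-ratio-< k {a} {b} {a′} {b′} {r} {s} {r′} {s′} b>0 below r/s≤r′/s′ above =
  ^-cancelˡ-< k (*-cancelʳ-< (s * s′) ((a′ * b) ^ k) ((a * b′) ^ k) (begin-strict
    (a′ * b) ^ k * (s * s′)     ≡⟨ trans (cong (_* (s * s′)) (*-^ a′ b k)) (rearrange₁ (a′ ^ k) (b ^ k) s s′) ⟩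
    (a′ ^ k * s) * (b ^ k * s′) <⟨ *-monoˡ-< (b ^ k * s′) {{bᵏs′≢0}} below ⟩
    (r * b′ ^ k) * (b ^ k * s′) ≡⟨ rearrange₂ r (b′ ^ k) (b ^ k) s′ ⟩
    (r * s′) * (b′ ^ k * b ^ k) ≤⟨ *-monoˡ-≤ (b′ ^ k * b ^ k) r/s≤r′/s′ ⟩
    (r′ * s) * (b′ ^ k * b ^ k) ≡⟨ rearrange₃ r′ s (b′ ^ k) (b ^ k) ⟩
    (r′ * b ^ k) * (s * b′ ^ k) ≤⟨ *-monoˡ-≤ (s * b′ ^ k) (<⇒≤ above) ⟩
    (a ^ k * s′) * (s * b′ ^ k) ≡⟨ trans (rearrange₄ (a ^ k) s′ s (b′ ^ k)) (cong (_* (s * s′)) (sym (*-^ a b′ k))) ⟩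
    (a * b′) ^ k * (s * s′)     ∎))
  where
    open ≤-Reasoning
    -- s′ ≠ 0, since otherwise `above` would read r′·b^k < 0
    s′≢0 : NonZero s′
    s′≢0 = >-nonZero (n≢0⇒n>0 λ { refl → n≮0 (≤-trans above (≤-reflexive (*-zeroʳ (a ^ k)))) })
    bᵏs′≢0 : NonZero (b ^ k * s′)
    bᵏs′≢0 = m*n≢0 (b ^ k) s′ {{>-nonZero (m^n>0 b {{>-nonZero b>0}} k)}} {{s′≢0}}
    rearrange₁ : ∀ A B s s′ → (A * B) * (s * s′) ≡ (A * s) * (B * s′)
    rearrange₁ = solve-∀
    rearrange₂ : ∀ r B′ B s′ → (r * B′) * (B * s′) ≡ (r * s′) * (B′ * B)
    rearrange₂ = solve-∀
    rearrange₃ : ∀ r′ s B′ B → (r′ * s) * (B′ * B) ≡ (r′ * B) * (s * B′)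
    rearrange₃ = solve-∀
    rearrange₄ : ∀ A s′ s B′ → (A * s′) * (s * B′) ≡ (A * B′) * (s * s′)
    rearrange₄ = solve-∀

-- If (log₂ n)^k is not ≥ r/s and r/s ≤ r′/s′, then (log₂ n)^k ≤ r′/s′.
-- Otherwise some a/b ≤ log₂ n has (a/b)^k > r′/s′, and then every
-- a′/b′ ≥ log₂ n has (a′/b′)^k ≥ (a/b)^k > r′/s′ ≥ r/s, so that
-- (log₂ n)^k ≥ r/s after all.
log-pow-le : ∀ k n r s r′ s′ → ¬ Log2PowGE k n r s → r * s′ ≤ r′ * s → Log2PowLE k n r′ s′
log-pow-le k n r s r′ s′ ¬ge r/s≤r′/s′ a b b>0 above with n ^ b <? 2 ^ a
... | yes n^b<2^a = n^b<2^a
... | no  n^b≮2^a = ⊥-elim (¬ge ge)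
  where
    ge : Log2PowGE k n r s
    ge a′ b′ _ below with 2 ^ a′ <? n ^ b′
    ... | yes 2^a′<n^b′ = 2^a′<n^b′
    ... | no  2^a′≮n^b′ = ⊥-elim (≤⇒≯
      (log-sandwich {n} {a} {b} {a′} {b′} (≮⇒≥ n^b≮2^a) (≮⇒≥ 2^a′≮n^b′))
      (power-ratio-< k {r = r} {r′ = r′} b>0 below r/s≤r′/s′ above))

telescope : ∀ (e : ℕ → ℕ) m N → (∀ k → k < N → e (suc k) + m ≤ e k) → e N + N * m ≤ e 0
telescope e m zero    _    = ≤-reflexive (+-identityʳ (e 0))
telescope e m (suc N) drop = begin
  e (suc N) + (m + N * m) ≡⟨ sym (+-assoc (e (suc N)) m (N * m)) ⟩
  (e (suc N) + m) + N * m ≤⟨ +-monoˡ-≤ (N * m) (drop N ≤-refl) ⟩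
  e N + N * m             ≤⟨ telescope e m N (λ k k<N → drop k (m<n⇒m<1+n k<N)) ⟩
  e 0                     ∎
  where open ≤-Reasoning

take-⊆ : ∀ {A : Set} k (xs : List A) → take k xs ⊆ xs
take-⊆ k xs = ⊆-reflexive (take++drop≡id k xs) ∘ xs⊆xs++ys (take k xs) _

lookup∷take⊆take-suc : ∀ {A : Set} (xs : List A) (i : Fin (length xs)) →
                       lookup xs i ∷ take (toℕ i) xs ⊆ take (suc (toℕ i)) xs
lookup∷take⊆take-suc xs i = ⊆-trans
  (∈-∷⁺ʳ (xs⊆ys++xs [ lookup xs i ] (take (toℕ i) xs) (here refl)) (xs⊆xs++ys _ _))
  (⊆-reflexive (sym (take-suc xs i)))

module Greedy {n : ℕ} (R : Rack n) {L : ℕ} {T : List (Fin n)} (isT : IsT R L T)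
              {j : Fin n} (jΔ : InSΔ R j) (j∉T : j ∉ T) {m : ℕ} (M : CardM R T j m) where
  open Connectivity R

  cp : List (Fin n) → ℕ
  cp S = proj₁ (cp-exists S)

  cp-spec : ∀ S → Cp R S (cp S)
  cp-spec S = proj₂ (cp-exists S)

  d : ℕ → ℕ
  d k = cp (take k T)

  greedy-step : ∀ (i : Fin (length T)) →
                (d (suc (toℕ i)) + d (suc (toℕ i))) + m ≤ d (toℕ i) + d (toℕ i)
  greedy-step i = ≤-trans (+-monoˡ-≤ m (+-mono-≤ next≤cpj next≤cpj))
                          (cp-drop (take-⊆ k T) (cp-spec P) (cp-spec (j ∷ P)) M)
    where
      k : ℕ
      k = toℕ i
      P : List (Fin n)
      P = take k T
      u : Fin n
      u = lookup T i
      -- u minimises cp(G_{P ∪ {v}}) over candidates v, and j is one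
      u-minimal : ∀ v → InSΔ R v → v ∉ P → ∀ c c′ → Cp R (u ∷ P) c → Cp R (v ∷ P) c′ → c ≤ c′
      u-minimal = proj₂ (proj₂ (proj₁ isT i))
      next≤cpj : d (suc k) ≤ cp (j ∷ P)
      next≤cpj = ≤-trans
        (cp-antitone (lookup∷take⊆take-suc T i) (cp-spec _) (cp-spec (u ∷ P)))
        (u-minimal j jΔ (j∉T ∘ take-⊆ k T) _ _ (cp-spec (u ∷ P)) (cp-spec (j ∷ P)))

  -- since j ∉ T is in S_{≤Δ}, T did not exhaust S_{≤Δ}: it has length L
  length≡L : length T ≡ L
  length≡L with proj₂ isT
  ... | inj₁ full           = full
  ... | inj₂ (_ , covers)  = ⊥-elim (j∉T (covers j jΔ))

  cardM-bound : suc L * m ≤ 2 * n * 1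
  cardM-bound = begin
    suc L * m         ≡⟨ cong (λ L → suc L * m) (sym length≡L) ⟩
    m + N * m         ≤⟨ +-monoˡ-≤ (N * m) (≤-trans m≤dN (m≤m+n (d N) (d N))) ⟩
    e N + N * m       ≤⟨ telescope e m N drop ⟩
    d 0 + d 0         ≤⟨ +-mono-≤ (cp-bound (cp-spec [])) (cp-bound (cp-spec [])) ⟩
    n + n             ≡⟨ cong (n +_) (sym (+-identityʳ n)) ⟩
    2 * n             ≡⟨ sym (*-identityʳ (2 * n)) ⟩
    2 * n * 1         ∎
    where
      open ≤-Reasoning
      N : ℕ
      N = length T
      e : ℕ → ℕ
      e k = d k + d k
      m≤dN : m ≤ d N
      m≤dN = cardM≤cp M (subst (λ S → Cp R S (d N)) (take-all N T ≤-refl) (cp-spec (take N T)))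
      drop : ∀ k → k < N → e (suc k) + m ≤ e k
      drop k k<N = subst (λ k → e (suc k) + m ≤ e k) (toℕ-fromℕ< k<N) (greedy-step (fromℕ< k<N))

lemma4p9 : (n : ℕ) → 2 ≤ n → (R : Rack n) →
    (L : ℕ) → IsL n L →
    (T : List (Fin n)) → IsT R L T →
    (j : Fin n) → InSΔ R j → j ∉ T →
    (m : ℕ) → CardM R T j m →
    Log2PowLE 2 n (2 * n) m
lemma4p9 n _ R L isL T isT j jΔ j∉T m M =
  log-pow-le 2 n (suc L) 1 (2 * n) m (proj₂ isL) (Greedy.cardM-bound R isT jΔ j∉T M)
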